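{- For $0<\alpha<\pi/2$ and any good input instance, the cost of the Straight-Up algorithm equals $\cot\alpha$.
   Context: Online drone coverage on a line. A drone at $T=(t_x,t_y)$, $t_y\ge0$, covers exactly the points $(x,0)$ with $|x-t_x|\le t_y\tan\alpha$. For $X=(x,0)$, $\mathrm{FC}(X)=\{(a,b):b\ge0,|a-x|\le b\tan\alpha\}$; for a finite set of points FC is the intersection. An input $\mathbf X=(X_0,\dots,X_n)$, $X_i=(x_i,0)$, is good if $X_0=(0,0)$, every request $X_i$ ($i\ge1$) satisfies $x_i\notin[\min_{j<i}x_j,\max_{j<i}x_j]$, and $\min_j x_j=-1$, $\max_j x_j\le1$. The Straight-Up algorithm starts at $P_0=(0,0)$ and in round $i$ moves to $P_i$, the lowest point of the $y$-axis lying in $\mathrm{FC}(\{X_0,\dots,X_i\})$; its cost is $\sum_{i=0}^{n-1}|P_iP_{i+1}|$. -}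

module Defs where

open import Level using (Level; _⊔_)
open import Data.Nat using (ℕ; zero; suc; _<_; _≤_)
open import Data.Fin using (Fin; zero; suc; toℕ; inject₁)
open import Data.Product using (Σ; _×_; _,_; ∃)
open import Data.Sum using (_⊎_; inj₁; inj₂)
open import Relation.Nullary using (¬_)
open import Relation.Binary.PropositionalEquality using (_≡_; _≢_)
open import Relation.Binary.Structures using (IsTotalOrder)
open import Algebra.Structures using (IsCommutativeRing)

-- An ordered commutative ring (ℝ is an instance).  Only the ordered-ring
-- axioms are assumed; equality is propositional equality.
record OrderedCommRing (c ℓ : Level) : Set (Level.suc (c ⊔ ℓ)) where
  infixl 6 _+_ _-_
  infixl 7 _*_
  infix 4 _≤ᵣ_ _<ᵣ_
  field
    Carrier : Set c
    _+_ _*_ : Carrier → Carrier → Carrier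
    -_      : Carrier → Carrier
    0# 1#   : Carrier
    _≤ᵣ_    : Carrier → Carrier → Set ℓ
    isCommutativeRing : IsCommutativeRing _≡_ _+_ _*_ -_ 0# 1#
    isTotalOrder      : IsTotalOrder _≡_ _≤ᵣ_
    0≢1   : 0# ≢ 1#
    +-mono : ∀ {x y} z → x ≤ᵣ y → x + z ≤ᵣ y + z
    *-pos  : ∀ {x y} → 0# ≤ᵣ x → 0# ≤ᵣ y → 0# ≤ᵣ x * y

  _-_ : Carrier → Carrier → Carrier
  x - y = x + (- y)

  _<ᵣ_ : Carrier → Carrier → Set (c ⊔ ℓ)
  x <ᵣ y = (x ≤ᵣ y) × (x ≢ y)

  ∣_∣ : Carrier → Carrier
  ∣ x ∣ with IsTotalOrder.total isTotalOrder 0# x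
  ... | inj₁ _ = x
  ... | inj₂ _ = - x

  Σᶠ : (n : ℕ) → (Fin n → Carrier) → Carrier
  Σᶠ zero    f = 0#
  Σᶠ (suc n) f = f zero + Σᶠ n (λ i → f (suc i))

module Drone {c ℓ} (R : OrderedCommRing c ℓ) where
  open OrderedCommRing R public

  -- t plays the role of tan α.
  -- (a , b) ∈ FC((x , 0)):  b ≥ 0 and |a - x| ≤ b tan α
  InFC : (t : Carrier) → (a b : Carrier) → (x : Carrier) → Set ℓ
  InFC t a b x = (0# ≤ᵣ b) × (∣ a - x ∣ ≤ᵣ b * t)

  InFCUpTo : ∀ {n} (t : Carrier) (x : Fin (suc n) → Carrier)
             (i : Fin (suc n)) (a b : Carrier) → Set ℓ
  InFCUpTo {n} t x i a b = ∀ (j : Fin (suc n)) → toℕ j ≤ toℕ i → InFC t a b (x j)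

  -- good input instance X_0,…,X_n with X_i = (x i , 0)
  Good : (n : ℕ) → (Fin (suc n) → Carrier) → Set (c ⊔ ℓ)
  Good n x =
      (x zero ≡ 0#)
    × (∀ (i : Fin (suc n)) → 0 < toℕ i →
         -- x_i ∉ [min_{j<i} x_j , max_{j<i} x_j]
         ¬ ((Σ (Fin (suc n)) λ j → (toℕ j < toℕ i) × (x j ≤ᵣ x i))
          × (Σ (Fin (suc n)) λ k → (toℕ k < toℕ i) × (x i ≤ᵣ x k))))
    × ((Σ (Fin (suc n)) λ j → x j ≡ - 1#) × (∀ j → - 1# ≤ᵣ x j))
    × (∀ j → x j ≤ᵣ 1#)

  LowestOnYAxis : ∀ {n} (t : Carrier) (x : Fin (suc n) → Carrier)
                  (i : Fin (suc n)) (b : Carrier) → Set (c ⊔ ℓ)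
  LowestOnYAxis t x i b =
    InFCUpTo t x i 0# b × (∀ b′ → InFCUpTo t x i 0# b′ → b ≤ᵣ b′)

  -- Straight-Up trajectory: P_0 = (0,0), and for rounds i ≥ 1, P_i = (0 , p i)
  -- is the lowest point of the y-axis in FC({X_0,…,X_i}).
  StraightUp : ∀ {n} (t : Carrier) (x : Fin (suc n) → Carrier)
               (p : Fin (suc n) → Carrier) → Set (c ⊔ ℓ)
  StraightUp {n} t x p =
    (p zero ≡ 0#) × (∀ (i : Fin n) → LowestOnYAxis t x (suc i) (p (suc i)))

  -- cost = Σ_{i=0}^{n-1} |P_i P_{i+1}|; both points lie on the y-axis,
  -- so the Euclidean distance is |p (i+1) - p i|.
  cost : ∀ {n} → (Fin (suc n) → Carrier) → Carrier
  cost {n} p = Σᶠ n (λ i → ∣ p (suc i) - p (inject₁ i) ∣)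

{-# OPTIONS --safe #-}
module Submission where

-- Adding requests only shrinks FC({X_0,…,X_i}), so the Straight-Up heights never
-- decrease and the cost telescopes to the final height.  All requests lie in
-- [-1, 1] and -1 is requested, so the final region meets the y-axis exactly in
-- the heights b with b tan α ≥ 1, whose least element is cot α.

open import Defs
open import Data.Nat using (ℕ; suc; zero; z≤n; _≤_)
import Data.Nat.Properties as ℕ
open import Data.Fin using (Fin; zero; suc; toℕ; inject₁; fromℕ)
open import Data.Fin.Properties using (≤fromℕ; i≤inject₁[j]⇒i≤1+j)
open import Data.Product using (_,_; proj₁; proj₂)
open import Data.Sum using (inj₁; inj₂)
open import Data.Empty using (⊥-elim)
open import Relation.Nullary using (¬_)
open import Relation.Binary.PropositionalEquality
  using (_≡_; _≢_; refl; sym; trans; cong; cong₂; subst; subst₂; module ≡-Reasoning)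
open import Relation.Binary.Structures using (IsTotalOrder)
open import Algebra.Structures using (IsCommutativeRing)
open import Algebra.Bundles using (CommutativeRing)
import Algebra.Properties.Ring as RingProperties

module OrderedCommRingProperties {c ℓ} (R : OrderedCommRing c ℓ) where
  open OrderedCommRing R
  open IsCommutativeRing isCommutativeRing
    using (+-assoc; +-comm; +-identityˡ; +-identityʳ; -‿inverseˡ; -‿inverseʳ;
           *-comm; *-assoc; *-identityˡ; *-identityʳ)
  open IsTotalOrder isTotalOrder using (total; antisym)
  open ≡-Reasoning

  commutativeRing : CommutativeRing c c
  commutativeRing = record { isCommutativeRing = isCommutativeRing }

  open RingProperties (CommutativeRing.ring commutativeRing) public
    using (-0#≈0#; -‿involutive; -1*x≈-x; -‿distribʳ-*; [y-z]x≈yx-zx)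

  x-0≡x : ∀ x → x - 0# ≡ x
  x-0≡x x = trans (cong (x +_) -0#≈0#) (+-identityʳ x)

  x-y+y≡x : ∀ x y → (x - y) + y ≡ x
  x-y+y≡x x y = begin
    (x - y) + y     ≡⟨ +-assoc x (- y) y ⟩
    x + (- y + y)   ≡⟨ cong (x +_) (-‿inverseˡ y) ⟩
    x + 0#          ≡⟨ +-identityʳ x ⟩
    x               ∎

  [y-x]+[z-y]≡z-x : ∀ x y z → (y - x) + (z - y) ≡ z - x
  [y-x]+[z-y]≡z-x x y z = begin
    (y - x) + (z - y)     ≡⟨ +-comm (y - x) (z - y) ⟩
    (z - y) + (y - x)     ≡⟨ +-assoc z (- y) (y - x) ⟩
    z + (- y + (y - x))   ≡⟨ cong (z +_) (sym (+-assoc (- y) y (- x))) ⟩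
    z + ((- y + y) - x)   ≡⟨ cong (λ w → z + (w - x)) (-‿inverseˡ y) ⟩
    z + (0# - x)          ≡⟨ cong (z +_) (+-identityˡ (- x)) ⟩
    z - x                 ∎

  x≤y⇒0≤y-x : ∀ {x y} → x ≤ᵣ y → 0# ≤ᵣ y - x
  x≤y⇒0≤y-x {x} x≤y = subst (_≤ᵣ _) (-‿inverseʳ x) (+-mono (- x) x≤y)

  0≤y-x⇒x≤y : ∀ {x y} → 0# ≤ᵣ y - x → x ≤ᵣ y
  0≤y-x⇒x≤y {x} {y} 0≤y-x = subst₂ _≤ᵣ_ (+-identityˡ x) (x-y+y≡x y x) (+-mono x 0≤y-x)

  neg-antimono-≤ : ∀ {x y} → x ≤ᵣ y → - y ≤ᵣ - x
  neg-antimono-≤ {x} {y} x≤y = 0≤y-x⇒x≤y (subst (0# ≤ᵣ_) y-x≡-x-[-y] (x≤y⇒0≤y-x x≤y))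
    where
    y-x≡-x-[-y] : y - x ≡ - x - - y
    y-x≡-x-[-y] = trans (+-comm y (- x)) (cong (- x +_) (sym (-‿involutive y)))

  x≤0⇒0≤-x : ∀ {x} → x ≤ᵣ 0# → 0# ≤ᵣ - x
  x≤0⇒0≤-x x≤0 = subst (_≤ᵣ _) -0#≈0# (neg-antimono-≤ x≤0)

  0≢-1 : 0# ≢ - 1#
  0≢-1 0≡-1 = 0≢1 (trans (sym -0#≈0#) (trans (cong -_ 0≡-1) (-‿involutive 1#)))

  0≤1 : 0# ≤ᵣ 1#
  0≤1 with total 0# 1#
  ... | inj₁ 0≤1 = 0≤1
  ... | inj₂ 1≤0 = subst (0# ≤ᵣ_) [-1]*[-1]≡1 (*-pos 0≤-1 0≤-1)
    where
    0≤-1 : 0# ≤ᵣ - 1#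
    0≤-1 = x≤0⇒0≤-x 1≤0
    [-1]*[-1]≡1 : - 1# * - 1# ≡ 1#
    [-1]*[-1]≡1 = trans (-1*x≈-x (- 1#)) (-‿involutive 1#)

  *-monoʳ-≤-nonNeg : ∀ {x y} z → 0# ≤ᵣ z → x ≤ᵣ y → x * z ≤ᵣ y * z
  *-monoʳ-≤-nonNeg {x} {y} z 0≤z x≤y =
    0≤y-x⇒x≤y (subst (0# ≤ᵣ_) ([y-z]x≈yx-zx z y x) (*-pos (x≤y⇒0≤y-x x≤y) 0≤z))

  0≤x⇒∣x∣≡x : ∀ {x} → 0# ≤ᵣ x → ∣ x ∣ ≡ x
  0≤x⇒∣x∣≡x {x} 0≤x with total 0# x
  ... | inj₁ _ = refl
  ... | inj₂ x≤0 with antisym 0≤x x≤0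
  ... | refl = -0#≈0#

  -y≤x≤y⇒∣x∣≤y : ∀ {x y} → - y ≤ᵣ x → x ≤ᵣ y → ∣ x ∣ ≤ᵣ y
  -y≤x≤y⇒∣x∣≤y {x} {y} -y≤x x≤y with total 0# x
  ... | inj₁ _ = x≤y
  ... | inj₂ _ = subst (- x ≤ᵣ_) (-‿involutive y) (neg-antimono-≤ -y≤x)

  x*y≡1⇒0≤y : ∀ {x y} → 0# ≤ᵣ x → x * y ≡ 1# → 0# ≤ᵣ y
  x*y≡1⇒0≤y {x} {y} 0≤x x*y≡1 with total 0# y
  ... | inj₁ 0≤y = 0≤y
  ... | inj₂ y≤0 = ⊥-elim (0≢1 (antisym 0≤1 1≤0))
    where
    0≤-1 : 0# ≤ᵣ - 1#
    0≤-1 = subst (0# ≤ᵣ_) (trans (sym (-‿distribʳ-* x y)) (cong -_ x*y≡1))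
                 (*-pos 0≤x (x≤0⇒0≤-x y≤0))
    1≤0 : 1# ≤ᵣ 0#
    1≤0 = subst₂ _≤ᵣ_ (-‿involutive 1#) -0#≈0# (neg-antimono-≤ 0≤-1)

  x*y≡1∧1≤z*x⇒y≤z : ∀ {x y z} → 0# ≤ᵣ y → x * y ≡ 1# → 1# ≤ᵣ z * x → y ≤ᵣ z
  x*y≡1∧1≤z*x⇒y≤z {x} {y} {z} 0≤y x*y≡1 1≤z*x =
    subst₂ _≤ᵣ_ (*-identityˡ y) z*x*y≡z (*-monoʳ-≤-nonNeg y 0≤y 1≤z*x)
    where
    z*x*y≡z : z * x * y ≡ z
    z*x*y≡z = trans (*-assoc z x y) (trans (cong (z *_) x*y≡1) (*-identityʳ z))

  Σᶠ-cong : ∀ n {f g : Fin n → Carrier} → (∀ i → f i ≡ g i) → Σᶠ n f ≡ Σᶠ n g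
  Σᶠ-cong zero    f≗g = refl
  Σᶠ-cong (suc n) f≗g = cong₂ _+_ (f≗g zero) (Σᶠ-cong n (λ i → f≗g (suc i)))

  Σᶠ-telescope : ∀ n (f : Fin (suc n) → Carrier) →
                 Σᶠ n (λ i → f (suc i) - f (inject₁ i)) ≡ f (fromℕ n) - f zero
  Σᶠ-telescope zero    f = sym (-‿inverseʳ (f zero))
  Σᶠ-telescope (suc n) f = begin
    (f (suc zero) - f zero) + Σᶠ n (λ i → f (suc (suc i)) - f (suc (inject₁ i)))
      ≡⟨ cong ((f (suc zero) - f zero) +_) (Σᶠ-telescope n (λ i → f (suc i))) ⟩
    (f (suc zero) - f zero) + (f (fromℕ (suc n)) - f (suc zero))
      ≡⟨ [y-x]+[z-y]≡z-x (f zero) (f (suc zero)) (f (fromℕ (suc n))) ⟩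
    f (fromℕ (suc n)) - f zero
      ∎

module DroneProperties {c ℓ} (R : OrderedCommRing c ℓ) where
  open Drone R
  open OrderedCommRingProperties R
  open IsCommutativeRing isCommutativeRing using (+-identityˡ; *-comm)
  open IsTotalOrder isTotalOrder using (antisym)
  open ≡-Reasoning

  cost-of-monotone : ∀ {n} (p : Fin (suc n) → Carrier) →
                     (∀ i → p (inject₁ i) ≤ᵣ p (suc i)) →
                     cost p ≡ p (fromℕ n) - p zero
  cost-of-monotone {n} p mono = begin
    cost p                                          ≡⟨ Σᶠ-cong n (λ i → 0≤x⇒∣x∣≡x (x≤y⇒0≤y-x (mono i))) ⟩
    Σᶠ n (λ i → p (suc i) - p (inject₁ i))          ≡⟨ Σᶠ-telescope n p ⟩
    p (fromℕ n) - p zero                            ∎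

  InFCUpTo-antitone : ∀ {n t x} {i i′ : Fin (suc n)} {a b} → toℕ i ≤ toℕ i′ →
                      InFCUpTo t x i′ a b → InFCUpTo t x i a b
  InFCUpTo-antitone i≤i′ inFC j j≤i = inFC j (ℕ.≤-trans j≤i i≤i′)

  straightUp-monotone : ∀ {n t x} p → StraightUp {n} t x p → ∀ i → p (inject₁ i) ≤ᵣ p (suc i)
  straightUp-monotone p (p0≡0 , lowest) zero =
    subst (_≤ᵣ _) (sym p0≡0) (proj₁ (proj₁ (lowest zero) zero z≤n))
  straightUp-monotone p (_ , lowest) (suc i) =
    proj₂ (lowest (inject₁ i)) _
      (InFCUpTo-antitone (i≤inject₁[j]⇒i≤1+j ℕ.≤-refl) (proj₁ (lowest (suc i))))

  InFCUpTo-fromℕ : ∀ {n t x a b} → InFCUpTo {n} t x (fromℕ n) a b → ∀ j → InFC t a b (x j)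
  InFCUpTo-fromℕ inFC j = inFC j (≤fromℕ j)

  inverse-covers-unit-interval : ∀ {t s x} → 0# ≤ᵣ s → t * s ≡ 1# →
                                 - 1# ≤ᵣ x → x ≤ᵣ 1# → InFC t 0# s x
  inverse-covers-unit-interval {t} {s} {x} 0≤s t*s≡1 -1≤x x≤1 = 0≤s , ∣0-x∣≤s*t
    where
    -x≤1 : - x ≤ᵣ 1#
    -x≤1 = subst (- x ≤ᵣ_) (-‿involutive 1#) (neg-antimono-≤ -1≤x)
    ∣0-x∣≤s*t : ∣ 0# - x ∣ ≤ᵣ s * t
    ∣0-x∣≤s*t = subst₂ _≤ᵣ_ (cong ∣_∣ (sym (+-identityˡ (- x)))) (sym (trans (*-comm s t) t*s≡1))
                  (-y≤x≤y⇒∣x∣≤y (neg-antimono-≤ x≤1) -x≤1)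

  covers-minus-one⇒inverse≤ : ∀ {t s b} → 0# ≤ᵣ s → t * s ≡ 1# →
                              InFC t 0# b (- 1#) → s ≤ᵣ b
  covers-minus-one⇒inverse≤ {t} {b = b} 0≤s t*s≡1 (_ , ∣0+1∣≤b*t) =
    x*y≡1∧1≤z*x⇒y≤z 0≤s t*s≡1 (subst (_≤ᵣ b * t) ∣0+1∣≡1 ∣0+1∣≤b*t)
    where
    ∣0+1∣≡1 : ∣ 0# - - 1# ∣ ≡ 1#
    ∣0+1∣≡1 = begin
      ∣ 0# - - 1# ∣   ≡⟨ cong ∣_∣ (+-identityˡ (- - 1#)) ⟩
      ∣ - - 1# ∣      ≡⟨ cong ∣_∣ (-‿involutive 1#) ⟩
      ∣ 1# ∣          ≡⟨ 0≤x⇒∣x∣≡x 0≤1 ⟩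
      1#              ∎

  ¬Good-zero : ∀ x → ¬ Good zero x
  ¬Good-zero x (x0≡0 , _ , ((zero , x0≡-1) , _) , _) = 0≢-1 (trans (sym x0≡0) x0≡-1)

  straightUp-final-height : ∀ {t s} → 0# ≤ᵣ t → t * s ≡ 1# →
                            ∀ {n x} p → Good n x → StraightUp t x p → p (fromℕ n) ≡ s
  straightUp-final-height _ _ {zero} {x} _ good _ = ⊥-elim (¬Good-zero x good)
  straightUp-final-height {t} {s} 0≤t t*s≡1 {suc m} p
    (_ , _ , ((k , xk≡-1) , -1≤x) , x≤1) (_ , lowest) = antisym height≤s s≤height
    where
    0≤s : 0# ≤ᵣ s
    0≤s = x*y≡1⇒0≤y 0≤t t*s≡1
    height≤s : p (fromℕ (suc m)) ≤ᵣ s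
    height≤s = proj₂ (lowest (fromℕ m)) s
                 (λ j _ → inverse-covers-unit-interval 0≤s t*s≡1 (-1≤x j) (x≤1 j))
    s≤height : s ≤ᵣ p (fromℕ (suc m))
    s≤height = covers-minus-one⇒inverse≤ 0≤s t*s≡1
                 (subst (InFC t 0# _) xk≡-1 (InFCUpTo-fromℕ (proj₁ (lowest (fromℕ m))) k))

lemma3 : ∀ {c ℓ} (R : OrderedCommRing c ℓ) →
         let open Drone R in
         -- t = tan α > 0 (i.e. 0 < α < π/2), cotα = cot α = 1 / t
         ∀ (t cotα : Carrier) → 0# <ᵣ t → t * cotα ≡ 1# →
         ∀ (n : ℕ) (x : Fin (suc n) → Carrier) → Good n x →
         ∀ (p : Fin (suc n) → Carrier) → StraightUp t x p →
         cost p ≡ cotα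
lemma3 R t cotα (0≤t , _) t*cotα≡1 n x good p straightUp = begin
  cost p                  ≡⟨ cost-of-monotone p (straightUp-monotone p straightUp) ⟩
  p (fromℕ n) - p zero    ≡⟨ cong₂ _-_ (straightUp-final-height 0≤t t*cotα≡1 p good straightUp)
                                          (proj₁ straightUp) ⟩
  cotα - 0#               ≡⟨ x-0≡x cotα ⟩
  cotα                    ∎
  where
  open Drone R
  open OrderedCommRingProperties R
  open DroneProperties R
  open ≡-Reasoning
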